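{- Let $G$ be a connected graph of order $n\ge 6$. Then (1) $\eta_p(G)=n$ if and only if $G$ is isomorphic to the complete graph $K_n$ or to the star $K_{1,n-1}$; and (2) $\eta_p(G)=n-1$ if and only if $G$ is isomorphic to the complete split graph $K_{n-2}\vee\overline{K_2}$ or to the graph $K_1\vee(K_1+K_{n-2})$.
   Context: All graphs are finite, simple, undirected and connected. $+$ denotes disjoint union, $\vee$ denotes join (disjoint union plus all edges between the two graphs), $\overline{K_m}$ is the edgeless graph on $m$ vertices. For $v\in V(G)$ and $S\subseteq V(G)$, $d(v,S)=\min\{d(v,w):w\in S\}$. For a partition $\Pi=\{S_1,\dots,S_k\}$ of $V(G)$, let $r(u|\Pi)=(d(u,S_1),\dots,d(u,S_k))$. $\Pi$ is resolving if $r(u|\Pi)\neq r(v|\Pi)$ for all distinct $u,v$; dominating if every vertex $v$ has $d(v,S_j)=1$ for some $j$. $\eta_p(G)$ is the minimum cardinality of a partition of $V(G)$ that is both resolving and dominating. -}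

module Defs where

open import Data.Nat using (ℕ; zero; suc; _<_; _≤_)
open import Data.Nat as ℕ using ()
open import Data.Bool using (Bool; true; false; _∧_; _∨_; not; T)
open import Data.Fin using (Fin; toℕ)
open import Data.Fin as Fin using ()
open import Data.Product using (Σ; ∃; ∃-syntax; _×_; _,_)
open import Data.Sum using (_⊎_)
open import Relation.Nullary using (¬_; does)
open import Relation.Binary.PropositionalEquality using (_≡_; _≢_)
open import Function.Bundles using (_↔_; Inverse)
open import Function.Definitions using (Surjective)
open import Level using (0ℓ)

record Graph (n : ℕ) : Set where
  field
    adj   : Fin n → Fin n → Bool
    adj-sym : ∀ u v → adj u v ≡ adj v u
    irref : ∀ u → adj u u ≡ false
open Graph public

data Walk {n : ℕ} (G : Graph n) : Fin n → Fin n → ℕ → Set where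
  here : ∀ {u} → Walk G u u zero
  step : ∀ {u w v k} → T (adj G u w) → Walk G w v k → Walk G u v (suc k)

Connected : ∀ {n} → Graph n → Set
Connected {n} G = ∀ (u v : Fin n) → ∃[ k ] Walk G u v k

-- A partition of V(G) into k classes, given by a surjective class map.
-- Class j is S_j = { v | cls v ≡ j }.
record Partition (n k : ℕ) : Set where
  field
    cls  : Fin n → Fin k
    onto : Surjective _≡_ _≡_ cls
open Partition public

-- Dist G P v j d :  d(v, S_j) = d  (distance from v to the nearest vertex of class j).
Dist : ∀ {n k} → Graph n → Partition n k → Fin n → Fin k → ℕ → Set
Dist {n} G P v j d =
  (∃[ w ] (cls P w ≡ j × Walk G v w d)) ×
  (∀ m → m < d → ∀ (w : Fin n) → cls P w ≡ j → ¬ Walk G v w m)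

-- Π is resolving: distinct vertices have distinct representations r(·|Π).
Resolving : ∀ {n k} → Graph n → Partition n k → Set
Resolving {n} {k} G P =
  ∀ (u v : Fin n) → u ≢ v →
    ∃[ j ] ∃[ du ] ∃[ dv ] (Dist G P u j du × Dist G P v j dv × du ≢ dv)

Dominating : ∀ {n k} → Graph n → Partition n k → Set
Dominating {n} {k} G P = ∀ (v : Fin n) → ∃[ j ] Dist G P v j 1

ResDomPartition : ∀ {n} → Graph n → ℕ → Set
ResDomPartition {n} G k = Σ (Partition n k) λ P → Resolving G P × Dominating G P

EtaP : ∀ {n} → Graph n → ℕ → Set
EtaP G m = ResDomPartition G m × (∀ k → ResDomPartition G k → m ≤ k)

_≅_ : ∀ {n} → Graph n → Graph n → Set
_≅_ {n} G H = Σ (Fin n ↔ Fin n) λ f →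
  ∀ u v → adj G u v ≡ adj H (Inverse.to f u) (Inverse.to f v)

_≠ᶠ_ : ∀ {n} → Fin n → Fin n → Bool
u ≠ᶠ v = not (does (u Fin.≟ v))

is0 is1 : ∀ {n} → Fin n → Bool
is0 u = does (toℕ u ℕ.≟ 0)
is1 u = does (toℕ u ℕ.≟ 1)

Complete : (n : ℕ) → Graph n
Complete n = record
  { adj = λ u v → u ≠ᶠ v ; adj-sym = symP ; irref = irr }
  where
  open import Relation.Binary.PropositionalEquality using (refl; sym)
  open import Relation.Nullary using (yes; no)
  symP : ∀ u v → (u ≠ᶠ v) ≡ (v ≠ᶠ u)
  symP u v with u Fin.≟ v | v Fin.≟ u
  ... | yes _ | yes _ = refl
  ... | no _ | no _ = refl
  ... | yes p | no q = Data.Empty.⊥-elim (q (sym p)) where import Data.Empty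
  ... | no p | yes q = Data.Empty.⊥-elim (p (sym q)) where import Data.Empty
  irr : ∀ u → (u ≠ᶠ u) ≡ false
  irr u with u Fin.≟ u
  ... | yes _ = refl
  ... | no ¬p = Data.Empty.⊥-elim (¬p refl) where import Data.Empty

module _ where
  open import Relation.Binary.PropositionalEquality using (refl; cong₂; trans)
  open import Data.Bool.Properties using (∧-comm)

  restrict : (n : ℕ) → (p : Fin n → Fin n → Bool) → (∀ u v → p u v ≡ p v u) → Graph n
  restrict n p ps = record
    { adj = λ u v → adj (Complete n) u v ∧ p u v
    ; adj-sym = λ u v → cong₂ _∧_ (Graph.adj-sym (Complete n) u v) (ps u v)
    ; irref = λ u → trans (cong₂ _∧_ (irref (Complete n) u) refl) refl }

  open import Data.Bool.Properties using (∨-comm; ∧-comm)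

  Star : (n : ℕ) → Graph n
  Star n = restrict n (λ u v → is0 u ∨ is0 v) (λ u v → ∨-comm (is0 u) (is0 v))

  -- The complete split graph K_{n-2} ∨ K̄_2: vertices 0 and 1 form the
  -- independent pair, all other pairs of distinct vertices are adjacent.
  SplitK2 : (n : ℕ) → Graph n
  SplitK2 n = restrict n
    (λ u v → not ((is0 u ∧ is1 v) ∨ (is1 u ∧ is0 v)))
    (λ u v → Relation.Binary.PropositionalEquality.cong not
       (trans (∨-comm (is0 u ∧ is1 v) (is1 u ∧ is0 v))
              (cong₂ _∨_ (∧-comm (is1 u) (is0 v)) (∧-comm (is0 u) (is1 v)))))

  pendSym : ∀ a b c d → (a ∨ b ∨ not (c ∨ d)) ≡ (b ∨ a ∨ not (d ∨ c))
  pendSym false false false false = refl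
  pendSym false false false true = refl
  pendSym false false true false = refl
  pendSym false false true true = refl
  pendSym false true c d = refl
  pendSym true false c d = refl
  pendSym true true c d = refl

  -- K_1 ∨ (K_1 + K_{n-2}): vertex 0 is universal, vertex 1 is adjacent only
  -- to 0, and vertices 2..n-1 form a clique.
  PendantK : (n : ℕ) → Graph n
  PendantK n = restrict n
    (λ u v → is0 u ∨ is0 v ∨ not (is1 u ∨ is1 v))
    (λ u v → pendSym (is0 u) (is0 v) (is1 u) (is1 v))

module Submission where

open import Defs
open import Data.Nat using (ℕ; _≤_; _∸_)
open import Data.Product using (_×_)
open import Data.Sum using (_⊎_)
open import Function.Bundles using (_⇔_)

-- The proof compares upper and lower bounds over a classification.
--  * Classification (`Classification.classify`): a connected graph of order
--    n ≥ 6 is K_n, the star K_{1,n-1}, the split graph K_{n-2} ∨ K̄₂, the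
--    pendant graph K₁ ∨ (K₁ + K_{n-2}), or it contains two disjoint vertex
--    pairs that can be merged simultaneously.  The case split is on whether
--    some vertex has two neighbours and two non-neighbours.
--  * Upper bounds: one criterion (`Distances.resolvingDominating`) shows that
--    singletons always form a resolving dominating partition, that merging
--    one suitable pair does so in the split and pendant graphs, and that
--    merging two pairs does so in the last case, so there η_p ≤ n-2.
--  * Lower bounds: two vertices of one class that are adjacent to all vertices
--    outside {u, v, p} and see p alike are never resolved (`twins`).  Hence
--    class maps are injective for K_n and K_{1,n-1} (η_p ≥ n), and injective
--    off one vertex for the split and pendant graphs (η_p ≥ n-1).
--  * Shapes are invariant under isomorphism, graphs of the same shape are
--    isomorphic, and the concrete graphs of Defs have the expected shapes.

open import Data.Nat using (zero; suc; _<_; z≤n; s≤s)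
import Data.Nat.Properties as ℕ
open import Data.Bool using (true; false; _∧_; _∨_; not)
open import Data.Bool.Properties using (T-≡; ∧-zeroʳ; ∨-zeroʳ; ∧-comm)
open import Data.Fin as F using (Fin)
import Data.Fin.Properties as FinP
open import Data.Fin.Permutation
  using (Permutation′; _⟨$⟩ʳ_; _⟨$⟩ˡ_; inverseˡ; inverseʳ; transpose; _∘ₚ_)
  renaming (id to idₚ)
open import Data.List using (List; []; _∷_; length; lookup)
open import Data.List.Relation.Unary.All using (All; all?; []; _∷_)
open import Data.List.Relation.Unary.All.Properties using (¬All⇒Any¬)
import Data.List.Relation.Unary.Any as Any
open import Data.List.Relation.Unary.Any.Properties using (lookup-index)
open import Data.List.Membership.Propositional using (_∈_)
import Data.Product
open import Data.Product using (∃; ∃-syntax; _,_; proj₁; proj₂)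
import Data.Sum
open import Data.Sum using (inj₁; inj₂; [_,_]′)
open import Data.Empty using (⊥; ⊥-elim)
open import Function using (_∘_)
open import Function.Bundles using (Equivalence; mk⇔)
open import Function.Definitions using (Surjective; Injective)
open import Relation.Nullary using (¬_; Dec; yes; no; contradiction)
open import Relation.Nullary.Decidable using (¬?; _×-dec_; True; toWitness; decidable-stable; toSum)
open import Relation.Binary.PropositionalEquality
  using (_≡_; _≢_; refl; sym; trans; cong; cong₂; subst; ≢-sym)

avoid : ∀ {n} (xs : List (Fin n)) → length xs < n → ∃[ y ] All (y ≢_) xs
avoid {n} xs short with FinP.any? (λ y → all? (λ x → ¬? (y F.≟ x)) xs)
... | yes found = found
... | no none = contradiction (FinP.injective⇒≤ position-injective) (ℕ.<⇒≱ short)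
  where
  member : ∀ y → y ∈ xs
  member y = Any.map (λ {x} → decidable-stable (y F.≟ x))
                     (¬All⇒Any¬ (λ x → ¬? (y F.≟ x)) xs (λ all → none (y , all)))
  position : Fin n → Fin (length xs)
  position y = Any.index (member y)
  position-injective : Injective _≡_ _≡_ position
  position-injective {y} {z} eq =
    trans (lookup-index (member y)) (trans (cong (lookup xs) eq) (sym (lookup-index (member z))))

-- For n ≥ 6, at most five vertices of Fin n can always be avoided.
-- (The length bound is checked by evaluation at each use.)
avoid≤5 : ∀ {n} → 6 ≤ n → (xs : List (Fin n)) → {True (length xs ℕ.≤? 5)} → ∃[ y ] All (y ≢_) xs
avoid≤5 six xs {bound} = avoid xs (ℕ.≤-trans (s≤s (toWitness bound)) six)

true≢false : true ≢ false
true≢false ()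

module Adjacency {n : ℕ} (G : Graph n) where
  infix 4 _~_ _≁_
  _~_ _≁_ : Fin n → Fin n → Set
  u ~ v = adj G u v ≡ true
  u ≁ v = adj G u v ≡ false

  ~-sym : ∀ {u v} → u ~ v → v ~ u
  ~-sym {u} {v} e = trans (adj-sym G v u) e

  ≁-sym : ∀ {u v} → u ≁ v → v ≁ u
  ≁-sym {u} {v} e = trans (adj-sym G v u) e

  ~≁-absurd : ∀ {u v} → u ~ v → u ≁ v → ⊥
  ~≁-absurd e ne = true≢false (trans (sym e) ne)

  ~⇒≢ : ∀ {u v} → u ~ v → u ≢ v
  ~⇒≢ {u} e refl = true≢false (trans (sym e) (irref G u))

  ~≁⇒≢ : ∀ {x u w} → x ~ u → x ≁ w → u ≢ w
  ~≁⇒≢ e ne refl = ~≁-absurd e ne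

  adjacent? : ∀ u v → u ~ v ⊎ u ≁ v
  adjacent? u v with adj G u v
  ... | true = inj₁ refl
  ... | false = inj₂ refl

  ~? : ∀ u v → Dec (u ~ v)
  ~? u v = adj G u v Data.Bool.≟ true

  ≁? : ∀ u v → Dec (u ≁ v)
  ≁? u v = adj G u v Data.Bool.≟ false

  walk-zero : ∀ {u v} → Walk G u v 0 → u ≡ v
  walk-zero here = refl

  walk-one : ∀ {u v} → Walk G u v 1 → u ~ v
  walk-one (step t here) = Equivalence.to T-≡ t

  edge : ∀ {u v} → u ~ v → Walk G u v 1
  edge e = step (Equivalence.from T-≡ e) here

  path₂ : ∀ {u x v} → u ~ x → x ~ v → Walk G u v 2
  path₂ e₁ e₂ = step (Equivalence.from T-≡ e₁) (edge e₂)

  walk? : ∀ u v k → Dec (Walk G u v k)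
  walk? u v zero with u F.≟ v
  ... | yes refl = yes here
  ... | no u≢v = no λ w → u≢v (walk-zero w)
  walk? u v (suc k) with FinP.any? (λ x → ~? u x ×-dec walk? x v k)
  ... | yes (x , e , w) = yes (step (Equivalence.from T-≡ e) w)
  ... | no none = no λ { (step {w = x} t w) → none (x , Equivalence.to T-≡ t , w) }

  walk-closed : (S : Fin n → Set) → (∀ {x y} → S x → x ~ y → S y) →
                ∀ {u v k} → S u → Walk G u v k → S v
  walk-closed S closed su here = su
  walk-closed S closed su (step t w) = walk-closed S closed (closed su (Equivalence.to T-≡ t)) w

  neighbour : Connected G → 2 ≤ n → ∀ x → ∃[ y ] x ~ y
  neighbour conn two x with avoid (x ∷ []) two
  ... | y , y≢x ∷ _ = firstStep (≢-sym y≢x) (proj₂ (conn x y))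
    where
    firstStep : ∀ {u v k} → u ≢ v → Walk G u v k → ∃[ y ] u ~ y
    firstStep u≢v here = ⊥-elim (u≢v refl)
    firstStep _ (step {w = y} t _) = y , Equivalence.to T-≡ t

module LeastWitness (Q : ℕ → Set) (Q? : ∀ m → Dec (Q m)) where
  Least : ℕ → Set
  Least d = Q d × (∀ m → m < d → ¬ Q m)

  noneBelowOrLeast : ∀ k → (∀ m → m < k → ¬ Q m) ⊎ ∃ Least
  noneBelowOrLeast zero = inj₁ λ m ()
  noneBelowOrLeast (suc k) with noneBelowOrLeast k
  ... | inj₂ least = inj₂ least
  ... | inj₁ none with Q? k
  ...   | yes q = inj₂ (k , q , none)
  ...   | no ¬q = inj₁ λ m m<1+k → [ none m , (λ { refl → ¬q }) ]′ (ℕ.m<1+n⇒m<n∨m≡n m<1+k)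

  least : ∀ k → Q k → ∃ Least
  least k q with noneBelowOrLeast k
  ... | inj₁ none = k , q , none
  ... | inj₂ found = found

module Distances {n k : ℕ} (G : Graph n) (P : Partition n k) where
  open Adjacency G

  C : Fin n → Fin k
  C = cls P

  member : Fin k → Fin n
  member j = proj₁ (onto P j)

  member-cls : ∀ j → C (member j) ≡ j
  member-cls j = proj₂ (onto P j) refl

  dist-unique : ∀ {u j d₁ d₂} → Dist G P u j d₁ → Dist G P u j d₂ → d₁ ≡ d₂
  dist-unique {d₁ = d₁} {d₂} ((w₁ , c₁ , p₁) , min₁) ((w₂ , c₂ , p₂) , min₂) =
    ℕ.≤-antisym (ℕ.≮⇒≥ λ lt → min₁ d₂ lt w₂ c₂ p₂) (ℕ.≮⇒≥ λ lt → min₂ d₁ lt w₁ c₁ p₁)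

  dist-exists : Connected G → ∀ u j → ∃[ d ] Dist G P u j d
  dist-exists conn u j
    with LeastWitness.least Reach Reach? _ (member j , member-cls j , proj₂ (conn u (member j)))
    where
    Reach : ℕ → Set
    Reach m = ∃[ w ] (C w ≡ j × Walk G u w m)
    Reach? : ∀ m → Dec (Reach m)
    Reach? m = FinP.any? λ w → (C w F.≟ j) ×-dec walk? u w m
  ... | d , reach , minimal = d , reach , λ m m<d w cw walk → minimal m m<d (w , cw , walk)

  dist-zero : ∀ {u j} → C u ≡ j → Dist G P u j 0
  dist-zero {u} cu = (u , cu , here) , λ m ()

  walk-zero-class : ∀ {u w j} → C w ≡ j → Walk G u w 0 → C u ≡ j
  walk-zero-class cw walk = subst (λ x → C x ≡ _) (sym (walk-zero walk)) cw

  dist-zero⇒in : ∀ {u j} → Dist G P u j 0 → C u ≡ j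
  dist-zero⇒in ((w , cw , walk) , _) = walk-zero-class cw walk

  dist-one : ∀ {u w j} → C u ≢ j → C w ≡ j → u ~ w → Dist G P u j 1
  dist-one cu cw e = (_ , cw , edge e) , λ { zero _ w′ cw′ walk → cu (walk-zero-class cw′ walk) ; (suc m) (s≤s ()) }

  dist-two : ∀ {u x w j} → C u ≢ j → (∀ w′ → C w′ ≡ j → u ≁ w′) →
             u ~ x → x ~ w → C w ≡ j → Dist G P u j 2
  dist-two {u} cu far ux xw cw = (_ , cw , path₂ ux xw) , short
    where
    short : ∀ m → m < 2 → ∀ w′ → C w′ ≡ _ → ¬ Walk G u w′ m
    short zero _ w′ cw′ walk = cu (walk-zero-class cw′ walk)
    short (suc zero) _ w′ cw′ walk = ~≁-absurd (walk-one walk) (far w′ cw′)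
    short (suc (suc m)) (s≤s (s≤s ()))

  dist-one⇒neighbour : ∀ {u j} → Dist G P u j 1 → C u ≢ j × ∃[ w ] (C w ≡ j × u ~ w)
  dist-one⇒neighbour {u} ((w , cw , walk) , min) = (λ cu → min 0 (s≤s z≤n) u cu here) , w , cw , walk-one walk

  dominating⇒neighbour : Dominating G P → ∀ v → ∃[ w ] (C w ≢ C v × v ~ w)
  dominating⇒neighbour dom v with dom v
  ... | j , D with dist-one⇒neighbour D
  ...   | cv , w , cw , e = w , (λ eq → cv (trans (sym eq) cw)) , e

  Separates : Fin k → Fin n → Fin n → Set
  Separates j u v = ∀ {d} → Dist G P u j d → Dist G P v j d → ⊥

  resolving⇒separates : Resolving G P → ∀ {u v} → u ≢ v → ∃[ j ] Separates j u v
  resolving⇒separates res {u} {v} u≢v with res u v u≢v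
  ... | j , du , dv , Du , Dv , du≢dv =
        j , λ Du′ Dv′ → du≢dv (trans (dist-unique Du Du′) (dist-unique Dv′ Dv))

  SeparatingNeighbour : Fin n → Fin n → Set
  SeparatingNeighbour u v = ∃[ w ] (C w ≢ C u × u ~ w × (∀ w′ → C w′ ≡ C w → v ≁ w′))

  resolvingDominating : Connected G →
    (∀ {u v} → u ≢ v → C u ≡ C v → SeparatingNeighbour u v ⊎ SeparatingNeighbour v u) →
    (∀ v → ∃[ w ] (C w ≢ C v × v ~ w)) →
    Resolving G P × Dominating G P
  resolvingDominating conn separate outward = resolving , dominating
    where
    distance : ∀ u j → ∃[ d ] Dist G P u j d
    distance = dist-exists conn
    oneVsOther : ∀ {u v} → SeparatingNeighbour u v →
                 ∃[ j ] ∃[ d ] (Dist G P u j 1 × Dist G P v j d × 1 ≢ d)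
    oneVsOther {u} {v} (w , cw , e , far) with distance v (C w)
    ... | d , Dv = C w , d , dist-one (≢-sym cw) refl e , Dv , λ { refl → noNeighbour Dv }
      where
      noNeighbour : Dist G P v (C w) 1 → ⊥
      noNeighbour D with dist-one⇒neighbour D
      ... | _ , w′ , cw′ , e′ = ~≁-absurd e′ (far w′ cw′)
    -- vertices of different classes are told apart by the class of u, at distance 0
    resolving : Resolving G P
    resolving u v u≢v with C u F.≟ C v
    ... | no cu≢cv with distance v (C u)
    ...   | d , Dv = C u , 0 , d , dist-zero refl , Dv ,
                    λ { refl → cu≢cv (sym (dist-zero⇒in Dv)) }
    resolving u v u≢v | yes cu≡cv with separate u≢v cu≡cv
    ... | inj₁ s = let (j , d , Du , Dv , ne) = oneVsOther s in j , 1 , d , Du , Dv , ne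
    ... | inj₂ s = let (j , d , Dv , Du , ne) = oneVsOther s in j , d , 1 , Du , Dv , ≢-sym ne
    dominating : Dominating G P
    dominating v with outward v
    ... | w , cw , e = C w , dist-one (≢-sym cw) refl e

Pair : ∀ {n} → Fin n → Fin n → Fin n → Fin n → Set
Pair a b x y = (x ≡ a × y ≡ b) ⊎ (x ≡ b × y ≡ a)

Pair-fst : ∀ {n} {a b x y : Fin n} → Pair a b x y → x ≡ a ⊎ x ≡ b
Pair-fst (inj₁ (x≡a , _)) = inj₁ x≡a
Pair-fst (inj₂ (x≡b , _)) = inj₂ x≡b

Pair-snd : ∀ {n} {a b x y : Fin n} → Pair a b x y → y ≡ a ⊎ y ≡ b
Pair-snd (inj₁ (_ , y≡b)) = inj₂ y≡b
Pair-snd (inj₂ (_ , y≡a)) = inj₁ y≡a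

-- The class map Fin (1+m) → Fin m that puts v into the class of u and
-- keeps every other vertex in a class of its own.
module Merge {m : ℕ} (u v : Fin (suc m)) (u≢v : u ≢ v) where
  merge : Fin (suc m) → Fin m
  merge x with v F.≟ x
  ... | yes _ = F.punchOut (≢-sym u≢v)
  ... | no v≢x = F.punchOut v≢x

  merge-off : ∀ {x} (v≢x : v ≢ x) → merge x ≡ F.punchOut v≢x
  merge-off {x} v≢x with v F.≟ x
  ... | yes v≡x = ⊥-elim (v≢x v≡x)
  ... | no _ = FinP.punchOut-cong v refl

  merge-fibre : ∀ {x y} → merge x ≡ merge y → x ≡ y ⊎ Pair u v x y
  merge-fibre {x} {y} eq with v F.≟ x | v F.≟ y
  ... | yes v≡x | yes v≡y = inj₁ (trans (sym v≡x) v≡y)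
  ... | yes v≡x | no v≢y = inj₂ (inj₂ (sym v≡x , sym (FinP.punchOut-injective (≢-sym u≢v) v≢y eq)))
  ... | no v≢x | yes v≡y = inj₂ (inj₁ (FinP.punchOut-injective v≢x (≢-sym u≢v) eq , sym v≡y))
  ... | no v≢x | no v≢y = inj₁ (FinP.punchOut-injective v≢x v≢y eq)

  merge-onto : Surjective _≡_ _≡_ merge
  merge-onto j = F.punchIn v j , λ { refl → trans (merge-off (≢-sym (FinP.punchInᵢ≢i v j))) (FinP.punchOut-punchIn v) }

  merged : Partition (suc m) m
  merged = record { cls = merge ; onto = merge-onto }

record DisjointPairs {n : ℕ} (a b c d : Fin n) : Set where
  field
    a≢b : a ≢ b
    c≢d : c ≢ d
    a≢c : a ≢ c
    a≢d : a ≢ d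
    b≢c : b ≢ c
    b≢d : b ≢ d

swapPairs : ∀ {n} {a b c d : Fin n} → DisjointPairs a b c d → DisjointPairs c d a b
swapPairs p = record { a≢b = c≢d ; c≢d = a≢b ; a≢c = ≢-sym a≢c ; a≢d = ≢-sym b≢c ; b≢c = ≢-sym a≢d ; b≢d = ≢-sym b≢d }
  where open DisjointPairs p

module MergeTwo {m : ℕ} {a b c d : Fin (suc (suc m))} (pairs : DisjointPairs a b c d) where
  open DisjointPairs pairs
  open Merge a b a≢b renaming (merge to first; merge-fibre to first-fibre; merge-onto to first-onto)

  first-injective : ∀ {x z} → z ≢ a → z ≢ b → first x ≡ first z → x ≡ z
  first-injective z≢a z≢b eq with first-fibre eq
  ... | inj₁ x≡z = x≡z
  ... | inj₂ (inj₁ (_ , z≡b)) = ⊥-elim (z≢b z≡b)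
  ... | inj₂ (inj₂ (_ , z≡a)) = ⊥-elim (z≢a z≡a)

  first-c≢d : first c ≢ first d
  first-c≢d eq = c≢d (first-injective (≢-sym a≢d) (≢-sym b≢d) eq)

  open Merge (first c) (first d) first-c≢d renaming (merge to second; merge-fibre to second-fibre; merge-onto to second-onto)

  mergeTwo : Fin (suc (suc m)) → Fin m
  mergeTwo x = second (first x)

  mergeTwo-fibre : ∀ {x y} → mergeTwo x ≡ mergeTwo y → x ≡ y ⊎ (Pair a b x y ⊎ Pair c d x y)
  mergeTwo-fibre {x} {y} eq with second-fibre eq
  ... | inj₂ (inj₁ (x↦c , y↦d)) = inj₂ (inj₂ (inj₁ (first-injective (≢-sym a≢c) (≢-sym b≢c) x↦c ,
                                                   first-injective (≢-sym a≢d) (≢-sym b≢d) y↦d)))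
  ... | inj₂ (inj₂ (x↦d , y↦c)) = inj₂ (inj₂ (inj₂ (first-injective (≢-sym a≢d) (≢-sym b≢d) x↦d ,
                                                   first-injective (≢-sym a≢c) (≢-sym b≢c) y↦c)))
  ... | inj₁ firstEq with first-fibre firstEq
  ...   | inj₁ x≡y = inj₁ x≡y
  ...   | inj₂ ab = inj₂ (inj₁ ab)

  mergedTwo : Partition (suc (suc m)) m
  mergedTwo = record
    { cls = mergeTwo
    ; onto = λ j → let (i , hit) = second-onto j ; (x , hit′) = first-onto i
                   in x , λ { refl → trans (cong second (hit′ refl)) (hit refl) } }

module MergedPartition {N K : ℕ} (G : Graph N) (P : Partition N K)
    (Merged : Fin N → Fin N → Set)
    (fibre : ∀ {x y} → cls P x ≡ cls P y → x ≡ y ⊎ Merged x y) where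
  open Adjacency G
  open Distances G P

  apart : ∀ {x y} → x ≢ y → ¬ Merged x y → C x ≢ C y
  apart x≢y unmerged eq = [ x≢y , unmerged ]′ (fibre eq)

  separatingNeighbour : ∀ {u v w} → u ~ w → ¬ Merged w u →
                        (∀ w′ → C w′ ≡ C w → v ≁ w′) → SeparatingNeighbour u v
  separatingNeighbour e unmerged far = _ , apart (≢-sym (~⇒≢ e)) unmerged , e , far

module Configurations {n : ℕ} (G : Graph n) where
  open Adjacency G

  NeighbourBesides : Fin n → Fin n → Set
  NeighbourBesides u v = ∃[ y ] (y ≢ v × u ~ y)

  record MergeablePair : Set where
    field
      u v w : Fin n
      u≢v : u ≢ v
      w≢v : w ≢ v
      u~w : u ~ w
      v≁w : v ≁ w
      v-besides : NeighbourBesides v u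

  Separated : Fin n → Fin n → Fin n → Fin n → Set
  Separated u v a b =
    (∃[ w ] (w ≢ v × w ≢ a × w ≢ b × u ~ w × v ≁ w)) ⊎ ((u ~ a ⊎ u ~ b) × v ≁ a × v ≁ b)

  record TwoMergeablePairs : Set where
    field
      a b c d : Fin n
      disjoint : DisjointPairs a b c d
      ab-separated : Separated a b c d
      cd-separated : Separated c d a b
      a-besides : NeighbourBesides a b
      b-besides : NeighbourBesides b a
      c-besides : NeighbourBesides c d
      d-besides : NeighbourBesides d c

mergeOnePair : ∀ {m} (G : Graph (suc m)) → Connected G → 2 ≤ suc m →
               Configurations.MergeablePair G → ResDomPartition G m
mergeOnePair G conn two pair = merged , resolvingDominating conn separate outward
  where
  open Adjacency G
  open Configurations.MergeablePair pair
  open Merge u v u≢v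
  open Distances G merged using (SeparatingNeighbour; resolvingDominating)
  open MergedPartition G merged (Pair u v) merge-fibre
  w≢u : w ≢ u
  w≢u = ≢-sym (~⇒≢ u~w)
  w-alone : ∀ w′ → merge w′ ≡ merge w → w′ ≡ w
  w-alone w′ eq = [ (λ w′≡w → w′≡w) , (λ m → ⊥-elim ([ w≢u , w≢v ]′ (Pair-snd m))) ]′ (merge-fibre eq)
  w-unmerged : ¬ Pair u v w u
  w-unmerged m = [ w≢u , w≢v ]′ (Pair-fst m)
  separation : SeparatingNeighbour u v
  separation = separatingNeighbour u~w w-unmerged (λ w′ eq → subst (v ≁_) (sym (w-alone w′ eq)) v≁w)
  separate : ∀ {x y} → x ≢ y → merge x ≡ merge y → SeparatingNeighbour x y ⊎ SeparatingNeighbour y x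
  separate x≢y eq with merge-fibre eq
  ... | inj₁ x≡y = ⊥-elim (x≢y x≡y)
  ... | inj₂ (inj₁ (refl , refl)) = inj₁ separation
  ... | inj₂ (inj₂ (refl , refl)) = inj₂ separation
  outward : ∀ x → ∃[ y ] (merge y ≢ merge x × x ~ y)
  outward x with x F.≟ u | x F.≟ v
  ... | yes refl | _ = w , apart w≢u w-unmerged , u~w
  ... | no _ | yes refl = let (y , y≢u , v~y) = v-besides in
        y , apart (≢-sym (~⇒≢ v~y)) (λ m → [ y≢u , ~⇒≢ v~y ∘ sym ]′ (Pair-fst m)) , v~y
  ... | no x≢u | no x≢v = let (y , x~y) = neighbour conn two x in
        y , apart (≢-sym (~⇒≢ x~y)) (λ m → [ x≢u , x≢v ]′ (Pair-snd m)) , x~y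

mergeTwoPairs : ∀ {m} (G : Graph (suc (suc m))) → Connected G → 2 ≤ suc (suc m) →
                Configurations.TwoMergeablePairs G → ResDomPartition G m
mergeTwoPairs G conn two pairs = mergedTwo , resolvingDominating conn separate outward
  where
  open Adjacency G
  open Configurations G using (NeighbourBesides; Separated)
  open Configurations.TwoMergeablePairs pairs
  open MergeTwo disjoint
  open Distances G mergedTwo using (SeparatingNeighbour; resolvingDominating)

  module Side {p q r s} (ps : DisjointPairs p q r s)
      (fibre : ∀ {x y} → mergeTwo x ≡ mergeTwo y → x ≡ y ⊎ (Pair p q x y ⊎ Pair r s x y)) where
    open DisjointPairs ps renaming (a≢b to p≢q; c≢d to r≢s; a≢c to p≢r; a≢d to p≢s; b≢c to q≢r; b≢d to q≢s)
    open MergedPartition G mergedTwo (λ x y → Pair p q x y ⊎ Pair r s x y) fibre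

    unmerged : ∀ {w x} → w ≢ p → w ≢ q → x ≢ r → x ≢ s → ¬ (Pair p q w x ⊎ Pair r s w x)
    unmerged w≢p w≢q x≢r x≢s =
      [ (λ pq → [ w≢p , w≢q ]′ (Pair-fst pq)) , (λ rs → [ x≢r , x≢s ]′ (Pair-snd rs)) ]′

    alone : ∀ {x} → x ≢ p → x ≢ q → x ≢ r → x ≢ s → ∀ y → mergeTwo y ≡ mergeTwo x → y ≡ x
    alone x≢p x≢q x≢r x≢s y eq =
      [ (λ y≡x → y≡x)
      , (λ m → ⊥-elim ([ (λ pq → [ x≢p , x≢q ]′ (Pair-snd pq)) , (λ rs → [ x≢r , x≢s ]′ (Pair-snd rs)) ]′ m)) ]′
      (fibre eq)

    inOtherPair : ∀ {z} → (z ≡ r ⊎ z ≡ s) → ∀ y → mergeTwo y ≡ mergeTwo z → y ≡ r ⊎ y ≡ s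
    inOtherPair z∈rs y eq with fibre eq
    ... | inj₁ refl = z∈rs
    ... | inj₂ (inj₂ (inj₁ (y≡r , _))) = inj₁ y≡r
    ... | inj₂ (inj₂ (inj₂ (y≡s , _))) = inj₂ y≡s
    ... | inj₂ (inj₁ (inj₁ (_ , refl))) = ⊥-elim ([ q≢r , q≢s ]′ z∈rs)
    ... | inj₂ (inj₁ (inj₂ (_ , refl))) = ⊥-elim ([ p≢r , p≢s ]′ z∈rs)

    missesPair : ∀ {y} → q ≁ r → q ≁ s → y ≡ r ⊎ y ≡ s → q ≁ y
    missesPair q≁r q≁s = [ (λ { refl → q≁r }) , (λ { refl → q≁s }) ]′

    separation : Separated p q r s → SeparatingNeighbour p q
    separation (inj₁ (w , w≢q , w≢r , w≢s , p~w , q≁w)) =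
      separatingNeighbour p~w (unmerged w≢p w≢q p≢r p≢s)
        (λ w′ eq → subst (q ≁_) (sym (alone w≢p w≢q w≢r w≢s w′ eq)) q≁w)
      where
      w≢p : w ≢ p
      w≢p = ≢-sym (~⇒≢ p~w)
    separation (inj₂ (inj₁ p~r , q≁r , q≁s)) =
      separatingNeighbour p~r (unmerged (≢-sym p≢r) (≢-sym q≢r) p≢r p≢s)
        (λ w′ eq → missesPair q≁r q≁s (inOtherPair (inj₁ refl) w′ eq))
    separation (inj₂ (inj₂ p~s , q≁r , q≁s)) =
      separatingNeighbour p~s (unmerged (≢-sym p≢s) (≢-sym q≢s) p≢r p≢s)
        (λ w′ eq → missesPair q≁r q≁s (inOtherPair (inj₂ refl) w′ eq))

    outward-p : NeighbourBesides p q → ∃[ y ] (mergeTwo y ≢ mergeTwo p × p ~ y)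
    outward-p (y , y≢q , p~y) = y , apart (≢-sym (~⇒≢ p~y)) (unmerged (≢-sym (~⇒≢ p~y)) y≢q p≢r p≢s) , p~y

    outward-q : NeighbourBesides q p → ∃[ y ] (mergeTwo y ≢ mergeTwo q × q ~ y)
    outward-q (y , y≢p , q~y) = y , apart (≢-sym (~⇒≢ q~y)) (unmerged y≢p (≢-sym (~⇒≢ q~y)) q≢r q≢s) , q~y

  module AB = Side disjoint mergeTwo-fibre
  module CD = Side (swapPairs disjoint) (λ eq → Data.Sum.map₂ Data.Sum.swap (mergeTwo-fibre eq))

  separate : ∀ {x y} → x ≢ y → mergeTwo x ≡ mergeTwo y → SeparatingNeighbour x y ⊎ SeparatingNeighbour y x
  separate x≢y eq with mergeTwo-fibre eq
  ... | inj₁ x≡y = ⊥-elim (x≢y x≡y)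
  ... | inj₂ (inj₁ (inj₁ (refl , refl))) = inj₁ (AB.separation ab-separated)
  ... | inj₂ (inj₁ (inj₂ (refl , refl))) = inj₂ (AB.separation ab-separated)
  ... | inj₂ (inj₂ (inj₁ (refl , refl))) = inj₁ (CD.separation cd-separated)
  ... | inj₂ (inj₂ (inj₂ (refl , refl))) = inj₂ (CD.separation cd-separated)

  outward : ∀ x → ∃[ y ] (mergeTwo y ≢ mergeTwo x × x ~ y)
  outward x with x F.≟ a | x F.≟ b | x F.≟ c | x F.≟ d
  ... | yes refl | _ | _ | _ = AB.outward-p a-besides
  ... | no _ | yes refl | _ | _ = AB.outward-q b-besides
  ... | no _ | no _ | yes refl | _ = CD.outward-p c-besides
  ... | no _ | no _ | no _ | yes refl = CD.outward-q d-besides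
  ... | no x≢a | no x≢b | no x≢c | no x≢d = let (y , x~y) = neighbour conn two x in
        y , (λ eq → ~⇒≢ x~y (sym (AB.alone x≢a x≢b x≢c x≢d y eq))) , x~y

module Shapes {n : ℕ} (G : Graph n) where
  open Adjacency G

  IsComplete : Set
  IsComplete = ∀ {u v} → u ≢ v → u ~ v

  record IsStar : Set where
    field
      centre : Fin n
      spoke : ∀ {u} → u ≢ centre → u ~ centre
      leaves-apart : ∀ {u v} → u ≢ centre → v ≢ centre → u ≁ v

  record IsSplit : Set where
    field
      a b : Fin n
      a≢b : a ≢ b
      a≁b : a ≁ b
      only-non-edge : ∀ {u v} → u ≢ v → u ≁ v → Pair a b u v

  module Split (split : IsSplit) where
    open IsSplit split public

    pair-non-adjacent : ∀ {u v} → Pair a b u v → u ≁ v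
    pair-non-adjacent (inj₁ (refl , refl)) = a≁b
    pair-non-adjacent (inj₂ (refl , refl)) = ≁-sym a≁b

    universal : ∀ {y} → y ≢ a → y ≢ b → ∀ {w} → w ≢ y → y ~ w
    universal {y} y≢a y≢b {w} w≢y with adjacent? y w
    ... | inj₁ y~w = y~w
    ... | inj₂ y≁w = ⊥-elim ([ y≢a , y≢b ]′ (Pair-fst (only-non-edge (≢-sym w≢y) y≁w)))

    a-sees : ∀ {y} → y ≢ a → y ≢ b → a ~ y
    a-sees y≢a y≢b = ~-sym (universal y≢a y≢b (≢-sym y≢a))

    b-sees : ∀ {y} → y ≢ a → y ≢ b → b ~ y
    b-sees y≢a y≢b = ~-sym (universal y≢a y≢b (≢-sym y≢b))

  record IsPendant : Set where
    field
      z p : Fin n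
      z≢p : z ≢ p
      z-universal : ∀ {u} → u ≢ z → z ~ u
      p-pendant : ∀ {u} → u ≢ z → p ≁ u
      clique : ∀ {u v} → u ≢ v → u ≢ p → v ≢ p → u ~ v

InjectiveOff : ∀ {n} {A : Set} → (Fin n → A) → Fin n → Set
InjectiveOff f x = ∀ {u v} → u ≢ x → v ≢ x → f u ≡ f v → u ≡ v

injectiveOff⇒≤ : ∀ {m k} (f : Fin (suc m) → Fin k) (x : Fin (suc m)) → InjectiveOff f x → m ≤ k
injectiveOff⇒≤ f x inj = FinP.injective⇒≤ {f = f ∘ F.punchIn x}
  (λ {i} {j} eq → FinP.punchIn-injective x i j (inj (FinP.punchInᵢ≢i x i) (FinP.punchInᵢ≢i x j) eq))

module LowerBounds {n k : ℕ} (G : Graph n) (P : Partition n k) (res : Resolving G P) where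
  open Adjacency G
  open Distances G P
  open Shapes G

  member≢ : ∀ {x w j} → C x ≢ j → C w ≡ j → w ≢ x
  member≢ cx≢j cw≡j refl = cx≢j cw≡j

  sameClassSeparated : ∀ {u v} → u ≢ v → C u ≡ C v → ∃[ j ] (C u ≢ j × C v ≢ j × Separates j u v)
  sameClassSeparated {u} {v} u≢v cu≡cv with resolving⇒separates res u≢v
  ... | j , sep = j , cu≢j , (λ cv≡j → cu≢j (trans cu≡cv cv≡j)) , sep
    where
    cu≢j : C u ≢ j
    cu≢j cu≡j = sep (dist-zero cu≡j) (dist-zero (trans (sym cu≡cv) cu≡j))

  otherMemberOrOnly : ∀ j p → (∃[ w ] (C w ≡ j × w ≢ p)) ⊎ (C p ≡ j × (∀ w → C w ≡ j → w ≡ p))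
  otherMemberOrOnly j p with FinP.any? (λ w → (C w F.≟ j) ×-dec ¬? (w F.≟ p))
  ... | yes found = inj₁ found
  ... | no none = inj₂ (subst (λ x → C x ≡ j) (only (member j) (member-cls j)) (member-cls j) , only)
    where
    only : ∀ w → C w ≡ j → w ≡ p
    only w cw = decidable-stable (w F.≟ p) (λ w≢p → none (w , cw , w≢p))

  twins : ∀ p {u v} → u ≢ v → C u ≡ C v →
          (∀ {w} → w ≢ u → w ≢ v → w ≢ p → u ~ w × v ~ w) →
          (u ≢ p → v ≢ p → (u ~ p × v ~ p) ⊎ (u ≁ p × v ≁ p × ∃[ x ] (u ~ x × v ~ x × x ~ p))) → ⊥
  twins p {u} {v} u≢v cu≡cv common seeP with sameClassSeparated u≢v cu≡cv
  ... | j , cu≢j , cv≢j , sep with otherMemberOrOnly j p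
  ...   | inj₁ (w , cw , w≢p) =
          let (u~w , v~w) = common (member≢ cu≢j cw) (member≢ cv≢j cw) w≢p
          in sep (dist-one cu≢j cw u~w) (dist-one cv≢j cw v~w)
  ...   | inj₂ (cp , only) with seeP (≢-sym (member≢ cu≢j cp)) (≢-sym (member≢ cv≢j cp))
  ...     | inj₁ (u~p , v~p) = sep (dist-one cu≢j cp u~p) (dist-one cv≢j cp v~p)
  ...     | inj₂ (u≁p , v≁p , x , u~x , v~x , x~p) =
            sep (dist-two cu≢j (missesClass u≁p) u~x x~p cp) (dist-two cv≢j (missesClass v≁p) v~x x~p cp)
    where
    missesClass : ∀ {y} → y ≁ p → ∀ w → C w ≡ j → y ≁ w
    missesClass y≁p w cw = subst (_ ≁_) (sym (only w cw)) y≁p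

  Shares : Fin n → Set
  Shares o = ∃[ y ] (y ≢ o × C y ≡ C o)

  shares? : ∀ o → Dec (Shares o)
  shares? o = FinP.any? λ y → ¬? (y F.≟ o) ×-dec (C y F.≟ C o)

  injectiveOff : ∀ x o → (∀ {u v} → u ≢ v → u ≢ x → u ≢ o → v ≢ x → v ≢ o → C u ≢ C v) →
                 ¬ Shares o → InjectiveOff C x
  injectiveOff x o apart oAlone {u} {v} u≢x v≢x eq with u F.≟ v | u F.≟ o | v F.≟ o
  ... | yes u≡v | _ | _ = u≡v
  ... | no u≢v | yes refl | _ = ⊥-elim (oAlone (v , ≢-sym u≢v , sym eq))
  ... | no u≢v | no _ | yes refl = ⊥-elim (oAlone (u , u≢v , eq))
  ... | no u≢v | no u≢o | no v≢o = ⊥-elim (apart u≢v u≢x u≢o v≢x v≢o eq)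

  completeInjective : IsComplete → Injective _≡_ _≡_ C
  completeInjective complete {u} {v} eq = decidable-stable (u F.≟ v) λ u≢v →
    twins u u≢v eq (λ w≢u w≢v _ → complete (≢-sym w≢u) , complete (≢-sym w≢v)) (λ u≢u _ → ⊥-elim (u≢u refl))

  starInjective : IsStar → Dominating G P → Injective _≡_ _≡_ C
  starInjective star dom {u} {v} eq = decidable-stable (u F.≟ v) λ u≢v → noShare u≢v eq
    where
    open IsStar star
    -- a leaf's only neighbour is the centre, so domination separates their classes
    leafApart : ∀ {x} → x ≢ centre → C x ≢ C centre
    leafApart {x} x≢c cx≡cc with dominating⇒neighbour dom x
    ... | w , cw≢cx , x~w with w F.≟ centre
    ...   | yes refl = cw≢cx (sym cx≡cc)
    ...   | no w≢c = ~≁-absurd x~w (leaves-apart x≢c w≢c)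
    noShare : ∀ {u v} → u ≢ v → C u ≡ C v → ⊥
    noShare {u} {v} u≢v eq with u F.≟ centre | v F.≟ centre
    ... | yes refl | _ = leafApart (≢-sym u≢v) (sym eq)
    ... | no u≢c | yes refl = leafApart u≢v eq
    ... | no u≢c | no v≢c with sameClassSeparated u≢v eq
    ...   | j , cu≢j , cv≢j , sep with C centre F.≟ j
    ...     | yes cc≡j = sep (dist-one cu≢j cc≡j (spoke u≢c)) (dist-one cv≢j cc≡j (spoke v≢c))
    ...     | no cc≢j = sep (dist-two cu≢j (farFrom u≢c) (spoke u≢c) centre~member (member-cls j))
                            (dist-two cv≢j (farFrom v≢c) (spoke v≢c) centre~member (member-cls j))
      where
      farFrom : ∀ {x} → x ≢ centre → ∀ w → C w ≡ j → x ≁ w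
      farFrom x≢c w cw = leaves-apart x≢c (member≢ cc≢j cw)
      centre~member : centre ~ member j
      centre~member = ~-sym (spoke (member≢ cc≢j (member-cls j)))

  module SplitBound (split : IsSplit) where
    open Split split

    -- a and b see the same vertices (all but each other)
    abApart : C a ≢ C b
    abApart eq = twins a a≢b eq (λ w≢a w≢b _ → a-sees w≢a w≢b , b-sees w≢a w≢b) (λ a≢a _ → ⊥-elim (a≢a refl))

    -- universal vertices see the same vertices
    universalApart : ∀ {u v} → u ≢ v → u ≢ a → u ≢ b → v ≢ a → v ≢ b → C u ≢ C v
    universalApart {u} u≢v u≢a u≢b v≢a v≢b eq =
      twins u u≢v eq (λ w≢u w≢v _ → universal u≢a u≢b w≢u , universal v≢a v≢b w≢v) (λ u≢u _ → ⊥-elim (u≢u refl))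

    -- a and b do not both share their classes: a vertex y sharing the class of a
    -- is told apart from a only by the class of b, which must then be {b}
    notBothShared : Shares a → Shares b → ⊥
    notBothShared (y , y≢a , cy≡ca) (y′ , y′≢b , cy′≡cb) with sameClassSeparated (≢-sym y≢a) (sym cy≡ca)
    ... | j , ca≢j , cy≢j , sep with otherMemberOrOnly j b
    ...   | inj₁ (w , cw , w≢b) =
            let y≢b = λ { refl → abApart (sym cy≡ca) } in
            sep (dist-one ca≢j cw (a-sees (member≢ ca≢j cw) w≢b))
                (dist-one cy≢j cw (universal y≢a y≢b (member≢ cy≢j cw)))
    ...   | inj₂ (cb≡j , only) = y′≢b (only y′ (trans cy′≡cb cb≡j))

    result : ∃[ x ] InjectiveOff C x
    result with shares? a
    ... | no aAlone = b , injectiveOff b a (λ u≢v u≢b u≢a v≢b v≢a → universalApart u≢v u≢a u≢b v≢a v≢b) aAlone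
    ... | yes aShared with shares? b
    ...   | no bAlone = a , injectiveOff a b universalApart bAlone
    ...   | yes bShared = ⊥-elim (notBothShared aShared bShared)

  module PendantBound (pendant : IsPendant) (dom : Dominating G P) where
    open IsPendant pendant

    -- two vertices outside {z, p} see everything but p, and reach p through z
    innerApart : ∀ {u v} → u ≢ v → u ≢ p → u ≢ z → v ≢ p → v ≢ z → C u ≢ C v
    innerApart u≢v u≢p u≢z v≢p v≢z eq = twins p u≢v eq
      (λ w≢u w≢v w≢p → clique (≢-sym w≢u) u≢p w≢p , clique (≢-sym w≢v) v≢p w≢p)
      (λ _ _ → inj₂ (≁-sym (p-pendant u≢z) , ≁-sym (p-pendant v≢z) ,
                     z , ~-sym (z-universal u≢z) , ~-sym (z-universal v≢z) , z-universal (≢-sym z≢p)))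

    -- p's only neighbour is z, so domination separates their classes
    pzApart : C p ≢ C z
    pzApart cp≡cz with dominating⇒neighbour dom p
    ... | w , cw≢cp , p~w with w F.≟ z
    ...   | yes refl = cw≢cp (sym cp≡cz)
    ...   | no w≢z = ~≁-absurd p~w (p-pendant w≢z)

    -- a vertex y sharing the class of z is told apart from z only by the
    -- class of p, which must then be {p}
    zShared⇒pAlone : Shares z → ¬ Shares p
    zShared⇒pAlone (y , y≢z , cy≡cz) (q , q≢p , cq≡cp) with sameClassSeparated (≢-sym y≢z) (sym cy≡cz)
    ... | j , cz≢j , cy≢j , sep with otherMemberOrOnly j p
    ...   | inj₁ (w , cw , w≢p) =
            let y≢p = λ { refl → pzApart cy≡cz } in
            sep (dist-one cz≢j cw (z-universal (member≢ cz≢j cw)))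
                (dist-one cy≢j cw (clique (≢-sym (member≢ cy≢j cw)) y≢p w≢p))
    ...   | inj₂ (cp≡j , only) = q≢p (only q (trans cq≡cp cp≡j))

    result : ∃[ x ] InjectiveOff C x
    result with shares? z
    ... | no zAlone = p , injectiveOff p z innerApart zAlone
    ... | yes zShared = z , injectiveOff z p (λ u≢v u≢z u≢p v≢z v≢p → innerApart u≢v u≢p u≢z v≢p v≢z)
                                         (zShared⇒pAlone zShared)

data Shape {n : ℕ} (G : Graph n) : Set where
  complete : Shapes.IsComplete G → Shape G
  star : Shapes.IsStar G → Shape G
  split : Shapes.IsSplit G → Shape G
  pendant : Shapes.IsPendant G → Shape G
  twoPairs : Configurations.TwoMergeablePairs G → Shape G

module Classification {n : ℕ} (G : Graph n) (six : 6 ≤ n) (conn : Connected G) where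
  open Adjacency G
  open Configurations G
  open Shapes G

  atLeastTwo : 2 ≤ n
  atLeastTwo = ℕ.≤-trans (s≤s (s≤s z≤n)) six

  nbr : ∀ x → ∃[ y ] x ~ y
  nbr = neighbour conn atLeastTwo

  besides? : ∀ v x → Dec (NeighbourBesides v x)
  besides? v x = FinP.any? λ y → ¬? (y F.≟ x) ×-dec ~? v y

  Leaf : Fin n → Fin n → Set
  Leaf v x = ∀ {y} → v ~ y → y ≡ x

  noneBesides⇒leaf : ∀ {v x} → ¬ NeighbourBesides v x → Leaf v x
  noneBesides⇒leaf {x = x} none {y} v~y = decidable-stable (y F.≟ x) (λ y≢x → none (y , y≢x , v~y))

  leaf-adjacent : ∀ {v x} → Leaf v x → v ~ x
  leaf-adjacent {v} leaf = let (y , v~y) = nbr v in subst (v ~_) (leaf v~y) v~y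

  leaf-misses : ∀ {v x y} → Leaf v x → y ≢ x → v ≁ y
  leaf-misses {v} {y = y} leaf y≢x = [ (λ v~y → ⊥-elim (y≢x (leaf v~y))) , (λ v≁y → v≁y) ]′ (adjacent? v y)

  leaf-unique : ∀ {v a b} → Leaf v a → Leaf v b → a ≡ b
  leaf-unique {v} leafA leafB = let (y , v~y) = nbr v in trans (sym (leafA v~y)) (leafB v~y)

  record TwoAndTwo (w : Fin n) : Set where
    field
      a b v₁ v₂ : Fin n
      a≢b : a ≢ b
      v₁≢v₂ : v₁ ≢ v₂
      w~a : w ~ a
      w~b : w ~ b
      w≁v₁ : w ≁ v₁
      w≁v₂ : w ≁ v₂
      v₁≢w : v₁ ≢ w
      v₂≢w : v₂ ≢ w

  AtMostOneMissing : Set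
  AtMostOneMissing = ∀ {w a b v₁ v₂} → a ≢ b → w ~ a → w ~ b → w ≁ v₁ → w ≁ v₂ → v₁ ≢ w → v₂ ≢ w → v₁ ≡ v₂

  dichotomy : (∃ TwoAndTwo) ⊎ AtMostOneMissing
  dichotomy with FinP.any? (λ w → FinP.any? λ a → FinP.any? λ b → FinP.any? λ v₁ → FinP.any? λ v₂ →
    ¬? (a F.≟ b) ×-dec ¬? (v₁ F.≟ v₂) ×-dec ~? w a ×-dec ~? w b ×-dec ≁? w v₁ ×-dec ≁? w v₂ ×-dec
    ¬? (v₁ F.≟ w) ×-dec ¬? (v₂ F.≟ w))
  ... | yes (w , a , b , v₁ , v₂ , a≢b , v₁≢v₂ , w~a , w~b , w≁v₁ , w≁v₂ , v₁≢w , v₂≢w) =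
        inj₁ (w , record { a = a ; b = b ; v₁ = v₁ ; v₂ = v₂ ; a≢b = a≢b ; v₁≢v₂ = v₁≢v₂ ; w~a = w~a ; w~b = w~b ; w≁v₁ = w≁v₁ ; w≁v₂ = w≁v₂
                          ; v₁≢w = v₁≢w ; v₂≢w = v₂≢w })
  ... | no none = inj₂ λ {w} {a} {b} {v₁} {v₂} a≢b w~a w~b w≁v₁ w≁v₂ v₁≢w v₂≢w →
        decidable-stable (v₁ F.≟ v₂) λ v₁≢v₂ →
          none (w , a , b , v₁ , v₂ , a≢b , v₁≢v₂ , w~a , w~b , w≁v₁ , w≁v₂ , v₁≢w , v₂≢w)

  module FromTwoAndTwo {w : Fin n} (t : TwoAndTwo w) where
    open TwoAndTwo t

    -- the pairs {b, v₁} and {a, v₂}, both separated by w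
    crossPairs : ∀ {a b} → a ≢ b → w ~ a → w ~ b →
                 NeighbourBesides v₁ b → NeighbourBesides v₂ a → TwoMergeablePairs
    crossPairs {a} {b} a≢b w~a w~b v₁-besides v₂-besides = record
      { a = b ; b = v₁ ; c = a ; d = v₂
      ; disjoint = record
          { a≢b = ~≁⇒≢ w~b w≁v₁ ; c≢d = ~≁⇒≢ w~a w≁v₂ ; a≢c = ≢-sym a≢b
          ; a≢d = ~≁⇒≢ w~b w≁v₂ ; b≢c = ≢-sym (~≁⇒≢ w~a w≁v₁) ; b≢d = v₁≢v₂ }
      ; ab-separated = inj₁ (w , ≢-sym v₁≢w , ~⇒≢ w~a , ≢-sym v₂≢w , ~-sym w~b , ≁-sym w≁v₁)
      ; cd-separated = inj₁ (w , ≢-sym v₂≢w , ~⇒≢ w~b , ≢-sym v₁≢w , ~-sym w~a , ≁-sym w≁v₂)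
      ; a-besides = w , ≢-sym v₁≢w , ~-sym w~b
      ; b-besides = v₁-besides
      ; c-besides = w , ≢-sym v₂≢w , ~-sym w~a
      ; d-besides = v₂-besides }

    -- v₁ and v₂ are leaves at x and y is another neighbour of w: the pairs {w, v₁}
    -- and {y, v₂}, each separated by the other pair
    leafPairs : ∀ {x y} → x ≢ y → w ~ x → w ~ y → Leaf v₁ x → Leaf v₂ x → TwoMergeablePairs
    leafPairs {x} {y} x≢y w~x w~y leaf₁ leaf₂ = record
      { a = w ; b = v₁ ; c = y ; d = v₂
      ; disjoint = record
          { a≢b = ≢-sym v₁≢w ; c≢d = ~≁⇒≢ w~y w≁v₂ ; a≢c = ~⇒≢ w~y
          ; a≢d = ≢-sym v₂≢w ; b≢c = ≢-sym (~≁⇒≢ w~y w≁v₁) ; b≢d = v₁≢v₂ }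
      ; ab-separated = inj₂ (inj₁ w~y , leaf-misses leaf₁ (≢-sym x≢y) , leaf-misses leaf₁ (≢-sym (~≁⇒≢ w~x w≁v₂)))
      ; cd-separated = inj₂ (inj₁ (~-sym w~y) , ≁-sym w≁v₂ , leaf-misses leaf₂ (≢-sym (~≁⇒≢ w~x w≁v₁)))
      ; a-besides = x , ~≁⇒≢ w~x w≁v₁ , w~x
      ; b-besides = x , ≢-sym (~⇒≢ w~x) , leaf-adjacent leaf₁
      ; c-besides = w , ≢-sym v₂≢w , ~-sym w~y
      ; d-besides = x , x≢y , leaf-adjacent leaf₂ }

    -- unless v₁, v₂ have neighbours besides b, a (or besides a, b), both are
    -- leaves at the same neighbour of w
    result : TwoMergeablePairs
    result with besides? v₁ b | besides? v₂ a | besides? v₁ a | besides? v₂ b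
    ... | yes v₁b | yes v₂a | _ | _ = crossPairs a≢b w~a w~b v₁b v₂a
    ... | _ | _ | yes v₁a | yes v₂b = crossPairs (≢-sym a≢b) w~b w~a v₁a v₂b
    ... | no ¬v₁b | _ | no ¬v₁a | _ = ⊥-elim (a≢b (leaf-unique (noneBesides⇒leaf ¬v₁a) (noneBesides⇒leaf ¬v₁b)))
    ... | _ | no ¬v₂a | _ | no ¬v₂b = ⊥-elim (a≢b (leaf-unique (noneBesides⇒leaf ¬v₂a) (noneBesides⇒leaf ¬v₂b)))
    ... | no ¬v₁b | _ | yes _ | no ¬v₂b =
          leafPairs (≢-sym a≢b) w~b w~a (noneBesides⇒leaf ¬v₁b) (noneBesides⇒leaf ¬v₂b)
    ... | yes _ | no ¬v₂a | no ¬v₁a | yes _ =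
          leafPairs a≢b w~a w~b (noneBesides⇒leaf ¬v₁a) (noneBesides⇒leaf ¬v₂a)

  module WithoutTwoAndTwo (atMostOne : AtMostOneMissing) where

    TwoNeighbours : Fin n → Set
    TwoNeighbours k = ∃[ a ] ∃[ b ] (a ≢ b × k ~ a × k ~ b)

    twoNeighbours? : ∀ k → Dec (TwoNeighbours k)
    twoNeighbours? k = FinP.any? λ a → FinP.any? λ b → ¬? (a F.≟ b) ×-dec ~? k a ×-dec ~? k b

    allBut : ∀ {k m} → TwoNeighbours k → k ≁ m → m ≢ k → ∀ {x} → x ≢ k → x ≢ m → k ~ x
    allBut {k} (a , b , a≢b , k~a , k~b) k≁m m≢k {x} x≢k x≢m =
      [ (λ k~x → k~x) , (λ k≁x → ⊥-elim (x≢m (sym (atMostOne a≢b k~a k~b k≁m k≁x m≢k x≢k)))) ]′ (adjacent? k x)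

    module HangingLeaf {l z} (leaf : Leaf l z) where
      l~z : l ~ z
      l~z = leaf-adjacent leaf

      l≢z : l ≢ z
      l≢z = ~⇒≢ l~z

      missesLeaf : ∀ {y} → y ≢ z → y ≁ l
      missesLeaf y≢z = ≁-sym (leaf-misses leaf y≢z)

      module WithBranch {k} (k≢l : k ≢ l) (k≢z : k ≢ z) (branch : TwoNeighbours k) where
        k-full : ∀ {x} → x ≢ k → x ≢ l → k ~ x
        k-full = allBut branch (missesLeaf k≢z) (≢-sym k≢l)

        -- a leaf y at k would leave a fresh vertex o with neighbours z, k and
        -- non-neighbours l, y
        noLeafAtK : ∀ {y} → y ≢ l → y ≢ z → y ≢ k → ¬ Leaf y k
        noLeafAtK {y} y≢l y≢z y≢k leafY with avoid≤5 six (l ∷ z ∷ k ∷ y ∷ [])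
        ... | o , o≢l ∷ o≢z ∷ o≢k ∷ o≢y ∷ [] =
              y≢l (sym (atMostOne z≢k (~-sym z~o) (~-sym (k-full o≢k o≢l))
                          (missesLeaf o≢z) (≁-sym (leaf-misses leafY o≢k)) (≢-sym o≢l) (≢-sym o≢y)))
          where
          z≢k : z ≢ k
          z≢k = ≢-sym k≢z
          z~k : z ~ k
          z~k = ~-sym (k-full z≢k (≢-sym l≢z))
          z~o : z ~ o
          z~o = allBut (l , k , ≢-sym k≢l , ~-sym l~z , z~k) (≁-sym (leaf-misses leafY z≢k)) y≢z o≢z o≢y

        allFull : ∀ {y} → y ≢ l → y ≢ z → ∀ {x} → x ≢ y → x ≢ l → y ~ x
        allFull {y} y≢l y≢z with y F.≟ k
        ... | yes refl = k-full
        ... | no y≢k with besides? y k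
        ...   | yes (y′ , y′≢k , y~y′) =
                allBut (k , y′ , ≢-sym y′≢k , ~-sym (k-full y≢k y≢l) , y~y′) (missesLeaf y≢z) (≢-sym y≢l)
        ...   | no none = ⊥-elim (noLeafAtK y≢l y≢z y≢k (noneBesides⇒leaf none))

        z-universal : ∀ {u} → u ≢ z → z ~ u
        z-universal {u} u≢z with u F.≟ l
        ... | yes refl = ~-sym l~z
        ... | no u≢l = ~-sym (allFull u≢l u≢z (≢-sym u≢z) (≢-sym l≢z))

        pendantShape : IsPendant
        pendantShape = record
          { z = z ; p = l ; z≢p = ≢-sym l≢z ; z-universal = z-universal
          ; p-pendant = leaf-misses leaf ; clique = clique }
          where
          clique : ∀ {u v} → u ≢ v → u ≢ l → v ≢ l → u ~ v
          clique {u} u≢v u≢l v≢l with u F.≟ z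
          ... | yes refl = z-universal (≢-sym u≢v)
          ... | no u≢z = allFull u≢l u≢z (≢-sym u≢v) v≢l

      module WithoutBranch (noBranch : ∀ {k} → k ≢ l → k ≢ z → ¬ TwoNeighbours k) where
        sameNeighbour : ∀ {k} → k ≢ l → k ≢ z → ∀ {a b} → k ~ a → k ~ b → a ≡ b
        sameNeighbour k≢l k≢z {a} {b} k~a k~b =
          decidable-stable (a F.≟ b) λ a≢b → noBranch k≢l k≢z (a , b , a≢b , k~a , k~b)

        -- an edge uy avoiding z would be a whole component, contradicting connectivity
        isolatedEdge : ∀ {u y} → u ≢ l → u ≢ z → u ~ y → y ≢ z → ⊥
        isolatedEdge {u} {y} u≢l u≢z u~y y≢z =
          [ (λ z≡u → u≢z (sym z≡u)) , (λ z≡y → y≢z (sym z≡y)) ]′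
            (walk-closed S closed (inj₁ refl) (proj₂ (conn u z)))
          where
          y≢l : y ≢ l
          y≢l refl = u≢z (leaf (~-sym u~y))
          S : Fin n → Set
          S x = x ≡ u ⊎ x ≡ y
          closed : ∀ {x x′} → S x → x ~ x′ → S x′
          closed (inj₁ refl) x~x′ = inj₂ (sameNeighbour u≢l u≢z x~x′ u~y)
          closed (inj₂ refl) x~x′ = inj₁ (sameNeighbour y≢l y≢z x~x′ (~-sym u~y))

        spoke : ∀ {u} → u ≢ z → u ~ z
        spoke {u} u≢z with u F.≟ l
        ... | yes refl = l~z
        ... | no u≢l = let (y , u~y) = nbr u in
              subst (u ~_) (decidable-stable (y F.≟ z) (isolatedEdge u≢l u≢z u~y)) u~y

        starShape : IsStar
        starShape = record { centre = z ; spoke = spoke ; leaves-apart = leavesApart }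
          where
          leavesApart : ∀ {u v} → u ≢ z → v ≢ z → u ≁ v
          leavesApart {u} {v} u≢z v≢z with adjacent? u v | u F.≟ l
          ... | inj₂ u≁v | _ = u≁v
          ... | inj₁ u~v | yes refl = ⊥-elim (v≢z (leaf u~v))
          ... | inj₁ u~v | no u≢l = ⊥-elim (v≢z (sameNeighbour u≢l u≢z u~v (spoke u≢z)))

      shape : Shape G
      shape with FinP.any? (λ k → ¬? (k F.≟ l) ×-dec ¬? (k F.≟ z) ×-dec twoNeighbours? k)
      ... | yes (k , k≢l , k≢z , branch) = pendant (WithBranch.pendantShape k≢l k≢z branch)
      ... | no none = star (WithoutBranch.starShape λ k≢l k≢z branch → none (_ , k≢l , k≢z , branch))

    -- no leaves: every vertex has two neighbours, so it misses at most one vertex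
    module NoLeaf (noLeaf : ∀ v x → NeighbourBesides v x) where
      missesAtMostOne : ∀ {x v₁ v₂} → x ≁ v₁ → x ≁ v₂ → v₁ ≢ x → v₂ ≢ x → v₁ ≡ v₂
      missesAtMostOne {x} =
        let (a , x~a) = nbr x ; (b , b≢a , x~b) = noLeaf x a in atMostOne (≢-sym b≢a) x~a x~b

      splitShape : ∀ {a b} → a ≢ b → a ≁ b →
                   (∀ {c d} → c ≢ d → c ≁ d → c ≢ a → c ≢ b → ⊥) → IsSplit
      splitShape {a} {b} a≢b a≁b noOther = record { a≢b = a≢b ; a≁b = a≁b ; only-non-edge = onlyNonEdge }
        where
        onlyNonEdge : ∀ {u v} → u ≢ v → u ≁ v → Pair a b u v
        onlyNonEdge {u} {v} u≢v u≁v with u F.≟ a | u F.≟ b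
        ... | yes refl | _ = inj₁ (refl , missesAtMostOne u≁v a≁b (≢-sym u≢v) (≢-sym a≢b))
        ... | no _ | yes refl = inj₂ (refl , missesAtMostOne u≁v (≁-sym a≁b) (≢-sym u≢v) a≢b)
        ... | no u≢a | no u≢b = ⊥-elim (noOther u≢v u≁v u≢a u≢b)

      -- two disjoint non-edges {a, b}, {c, d}: with fresh vertices e, f the pairs
      -- {e, a} and {f, c} are mergeable, separated by b and d
      twoNonEdges : ∀ {a b c d} → a ≢ b → a ≁ b → c ≢ d → c ≁ d → c ≢ a → c ≢ b → TwoMergeablePairs
      twoNonEdges {a} {b} {c} {d} a≢b a≁b c≢d c≁d c≢a c≢b
        with avoid≤5 six (a ∷ b ∷ c ∷ d ∷ [])
      ... | e , e≢a ∷ e≢b ∷ e≢c ∷ e≢d ∷ [] with avoid≤5 six (a ∷ b ∷ c ∷ d ∷ e ∷ [])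
      ...   | f , f≢a ∷ f≢b ∷ f≢c ∷ f≢d ∷ f≢e ∷ [] = record
              { a = e ; b = a ; c = f ; d = c
              ; disjoint = record
                  { a≢b = e≢a ; c≢d = f≢c ; a≢c = ≢-sym f≢e ; a≢d = e≢c ; b≢c = ≢-sym f≢a ; b≢d = ≢-sym c≢a }
              ; ab-separated = inj₁ (b , ≢-sym a≢b , ≢-sym f≢b , ≢-sym c≢b , e~b , a≁b)
              ; cd-separated = inj₁ (d , ≢-sym c≢d , ≢-sym e≢d , d≢a , f~d , c≁d)
              ; a-besides = b , ≢-sym a≢b , e~b
              ; b-besides = noLeaf a e
              ; c-besides = d , ≢-sym c≢d , f~d
              ; d-besides = noLeaf c f }
        where
        d≢a : d ≢ a
        d≢a refl = c≢b (missesAtMostOne (≁-sym c≁d) a≁b c≢d (≢-sym a≢b))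
        e~b : e ~ b
        e~b = ~-sym ([ (λ b~e → b~e) , (λ b≁e → ⊥-elim (e≢a (missesAtMostOne b≁e (≁-sym a≁b) e≢b a≢b))) ]′ (adjacent? b e))
        f~d : f ~ d
        f~d = ~-sym ([ (λ d~f → d~f) , (λ d≁f → ⊥-elim (f≢c (missesAtMostOne d≁f (≁-sym c≁d) f≢d c≢d))) ]′ (adjacent? d f))

      shape : Shape G
      shape with FinP.any? (λ a → FinP.any? λ b → ¬? (a F.≟ b) ×-dec ≁? a b)
      ... | no none = complete λ {u} {v} u≢v →
              [ (λ u~v → u~v) , (λ u≁v → ⊥-elim (none (u , v , u≢v , u≁v))) ]′ (adjacent? u v)
      ... | yes (a , b , a≢b , a≁b)
            with FinP.any? (λ c → FinP.any? λ d → ¬? (c F.≟ d) ×-dec ≁? c d ×-dec ¬? (c F.≟ a) ×-dec ¬? (c F.≟ b))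
      ...   | yes (c , d , c≢d , c≁d , c≢a , c≢b) = twoPairs (twoNonEdges a≢b a≁b c≢d c≁d c≢a c≢b)
      ...   | no none = split (splitShape a≢b a≁b λ c≢d c≁d c≢a c≢b → none (_ , _ , c≢d , c≁d , c≢a , c≢b))

    shape : Shape G
    shape with FinP.any? (λ l → FinP.any? λ z → ¬? (besides? l z))
    ... | yes (l , z , none) = HangingLeaf.shape (noneBesides⇒leaf none)
    ... | no noLeaf = NoLeaf.shape λ v x → decidable-stable (besides? v x) λ none → noLeaf (v , x , none)

  classify : Shape G
  classify with dichotomy
  ... | inj₁ (w , t) = twoPairs (FromTwoAndTwo.result t)
  ... | inj₂ atMostOne = WithoutTwoAndTwo.shape atMostOne

⟨$⟩ʳ-injective : ∀ {n} (π : Permutation′ n) {x y} → π ⟨$⟩ʳ x ≡ π ⟨$⟩ʳ y → x ≡ y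
⟨$⟩ʳ-injective π eq = trans (sym (inverseˡ π)) (trans (cong (π ⟨$⟩ˡ_) eq) (inverseˡ π))

⟨$⟩ʳ-avoids : ∀ {n} (π : Permutation′ n) {a a′ u} → π ⟨$⟩ʳ a ≡ a′ → u ≢ a → π ⟨$⟩ʳ u ≢ a′
⟨$⟩ʳ-avoids π πa u≢a πu = u≢a (⟨$⟩ʳ-injective π (trans πu (sym πa)))

transpose-source : ∀ {n} (i j : Fin n) → transpose i j ⟨$⟩ʳ i ≡ j
transpose-source i j with i F.≟ i
... | yes _ = refl
... | no i≢i = ⊥-elim (i≢i refl)

transpose-fixes : ∀ {n} (i j k : Fin n) → k ≢ i → k ≢ j → transpose i j ⟨$⟩ʳ k ≡ k
transpose-fixes i j k k≢i k≢j with k F.≟ i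
... | yes k≡i = ⊥-elim (k≢i k≡i)
... | no _ with k F.≟ j
...   | yes k≡j = ⊥-elim (k≢j k≡j)
...   | no _ = refl

twoPointPermutation : ∀ {n} {a b a′ b′ : Fin n} → a ≢ b → a′ ≢ b′ →
                      ∃[ π ] (π ⟨$⟩ʳ a ≡ a′ × π ⟨$⟩ʳ b ≡ b′)
twoPointPermutation {n} {a} {b} {a′} {b′} a≢b a′≢b′ = π₁ ∘ₚ π₂ , sends-a , transpose-source b₁ b′
  where
  π₁ : Permutation′ n
  π₁ = transpose a a′
  b₁ : Fin n
  b₁ = π₁ ⟨$⟩ʳ b
  π₂ : Permutation′ n
  π₂ = transpose b₁ b′
  sends-a : π₂ ⟨$⟩ʳ (π₁ ⟨$⟩ʳ a) ≡ a′
  sends-a = trans (cong (π₂ ⟨$⟩ʳ_) (transpose-source a a′))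
                  (transpose-fixes b₁ b′ a′ (⟨$⟩ʳ-avoids π₁ (transpose-source a a′) (≢-sym a≢b) ∘ sym) a′≢b′)

module SameShape {N : ℕ} {G H : Graph N} where
  module G = Adjacency G
  module H = Adjacency H
  open Shapes

  Agrees : Permutation′ N → Fin N → Fin N → Set
  Agrees π u v = adj G u v ≡ adj H (π ⟨$⟩ʳ u) (π ⟨$⟩ʳ v)

  both : ∀ {u v x y} → u G.~ v → x H.~ y → adj G u v ≡ adj H x y
  both u~v x~y = trans u~v (sym x~y)

  neither : ∀ {u v x y} → u G.≁ v → x H.≁ y → adj G u v ≡ adj H x y
  neither u≁v x≁y = trans u≁v (sym x≁y)

  -- agreement on distinct pairs suffices, both graphs being loopless
  offDiagonal : (π : Permutation′ N) → (∀ {u v} → u ≢ v → Agrees π u v) → G ≅ H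
  offDiagonal π agree = π , agreeAll
    where
    agreeAll : ∀ u v → Agrees π u v
    agreeAll u v with u F.≟ v
    ... | yes refl = trans (irref G u) (sym (irref H (π ⟨$⟩ʳ u)))
    ... | no u≢v = agree u≢v

  complete≅ : IsComplete G → IsComplete H → G ≅ H
  complete≅ completeG completeH = offDiagonal idₚ λ u≢v → both (completeG u≢v) (completeH u≢v)

  -- swap the two centres
  star≅ : IsStar G → IsStar H → G ≅ H
  star≅ starG starH = offDiagonal π agree
    where
    module SG = IsStar starG
    module SH = IsStar starH
    π : Permutation′ N
    π = transpose SG.centre SH.centre
    f : Fin N → Fin N
    f = π ⟨$⟩ʳ_
    centre↦ : f SG.centre ≡ SH.centre
    centre↦ = transpose-source SG.centre SH.centre
    leaf↦ : ∀ {u} → u ≢ SG.centre → f u ≢ SH.centre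
    leaf↦ = ⟨$⟩ʳ-avoids π centre↦
    agree : ∀ {u v} → u ≢ v → Agrees π u v
    agree {u} {v} u≢v = [ centreFirst , (λ u≢c → [ centreSecond u≢c , twoLeaves u≢c ]′ (toSum (v F.≟ SG.centre))) ]′
                              (toSum (u F.≟ SG.centre))
      where
      centreFirst : u ≡ SG.centre → Agrees π u v
      centreFirst refl = both (G.~-sym (SG.spoke (≢-sym u≢v)))
                              (subst (H._~ f v) (sym centre↦) (H.~-sym (SH.spoke (leaf↦ (≢-sym u≢v)))))
      centreSecond : u ≢ SG.centre → v ≡ SG.centre → Agrees π u v
      centreSecond u≢c refl = both (SG.spoke u≢c) (subst (f u H.~_) (sym centre↦) (SH.spoke (leaf↦ u≢c)))
      twoLeaves : u ≢ SG.centre → v ≢ SG.centre → Agrees π u v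
      twoLeaves u≢c v≢c = neither (SG.leaves-apart u≢c v≢c) (SH.leaves-apart (leaf↦ u≢c) (leaf↦ v≢c))

  -- move the non-adjacent pair of G onto that of H
  split≅ : IsSplit G → IsSplit H → G ≅ H
  split≅ splitG splitH = offDiagonal π agree
    where
    module SG = IsSplit splitG
    module SH = IsSplit splitH
    moves : ∃[ π ] (π ⟨$⟩ʳ SG.a ≡ SH.a × π ⟨$⟩ʳ SG.b ≡ SH.b)
    moves = twoPointPermutation SG.a≢b SH.a≢b
    π : Permutation′ N
    π = proj₁ moves
    f : Fin N → Fin N
    f = π ⟨$⟩ʳ_
    a↦ : f SG.a ≡ SH.a
    a↦ = proj₁ (proj₂ moves)
    b↦ : f SG.b ≡ SH.b
    b↦ = proj₂ (proj₂ moves)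
    image : ∀ {u v} → Pair SG.a SG.b u v → Pair SH.a SH.b (f u) (f v)
    image (inj₁ (refl , refl)) = inj₁ (a↦ , b↦)
    image (inj₂ (refl , refl)) = inj₂ (b↦ , a↦)
    preimage : ∀ {u v} → Pair SH.a SH.b (f u) (f v) → Pair SG.a SG.b u v
    preimage (inj₁ (fu , fv)) = inj₁ (⟨$⟩ʳ-injective π (trans fu (sym a↦)) , ⟨$⟩ʳ-injective π (trans fv (sym b↦)))
    preimage (inj₂ (fu , fv)) = inj₂ (⟨$⟩ʳ-injective π (trans fu (sym b↦)) , ⟨$⟩ʳ-injective π (trans fv (sym a↦)))
    agree : ∀ {u v} → u ≢ v → Agrees π u v
    agree {u} {v} u≢v with G.adjacent? u v | H.adjacent? (f u) (f v)
    ... | inj₁ u~v | inj₁ fu~fv = both u~v fu~fv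
    ... | inj₂ u≁v | _ = neither u≁v (Split.pair-non-adjacent H splitH (image (SG.only-non-edge u≢v u≁v)))
    ... | inj₁ u~v | inj₂ fu≁fv = ⊥-elim (G.~≁-absurd u~v
            (Split.pair-non-adjacent G splitG (preimage (SH.only-non-edge (⟨$⟩ʳ-avoids π refl u≢v) fu≁fv))))

  -- move the universal and the pendant vertex of G onto those of H
  pendant≅ : IsPendant G → IsPendant H → G ≅ H
  pendant≅ pendantG pendantH = offDiagonal π agree
    where
    module PG = IsPendant pendantG
    module PH = IsPendant pendantH
    moves : ∃[ π ] (π ⟨$⟩ʳ PG.z ≡ PH.z × π ⟨$⟩ʳ PG.p ≡ PH.p)
    moves = twoPointPermutation PG.z≢p PH.z≢p
    π : Permutation′ N
    π = proj₁ moves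
    f : Fin N → Fin N
    f = π ⟨$⟩ʳ_
    z↦ : f PG.z ≡ PH.z
    z↦ = proj₁ (proj₂ moves)
    p↦ : f PG.p ≡ PH.p
    p↦ = proj₂ (proj₂ moves)
    z-avoided : ∀ {u} → u ≢ PG.z → f u ≢ PH.z
    z-avoided = ⟨$⟩ʳ-avoids π z↦
    agree : ∀ {u v} → u ≢ v → Agrees π u v
    agree {u} {v} u≢v =
      [ zFirst , (λ u≢z → [ zSecond u≢z , (λ v≢z →
      [ pFirst v≢z , (λ u≢p → [ pSecond u≢z , clique u≢p ]′ (toSum (v F.≟ PG.p))) ]′ (toSum (u F.≟ PG.p)))
      ]′ (toSum (v F.≟ PG.z))) ]′ (toSum (u F.≟ PG.z))
      where
      zFirst : u ≡ PG.z → Agrees π u v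
      zFirst refl = both (PG.z-universal (≢-sym u≢v))
                         (subst (H._~ f v) (sym z↦) (PH.z-universal (z-avoided (≢-sym u≢v))))
      zSecond : u ≢ PG.z → v ≡ PG.z → Agrees π u v
      zSecond u≢z refl = both (G.~-sym (PG.z-universal u≢z))
                              (subst (f u H.~_) (sym z↦) (H.~-sym (PH.z-universal (z-avoided u≢z))))
      pFirst : v ≢ PG.z → u ≡ PG.p → Agrees π u v
      pFirst v≢z refl = neither (PG.p-pendant v≢z) (subst (H._≁ f v) (sym p↦) (PH.p-pendant (z-avoided v≢z)))
      pSecond : u ≢ PG.z → v ≡ PG.p → Agrees π u v
      pSecond u≢z refl = neither (G.≁-sym (PG.p-pendant u≢z))
                                 (subst (f u H.≁_) (sym p↦) (H.≁-sym (PH.p-pendant (z-avoided u≢z))))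
      clique : u ≢ PG.p → v ≢ PG.p → Agrees π u v
      clique u≢p v≢p = both (PG.clique u≢v u≢p v≢p)
                            (PH.clique (⟨$⟩ʳ-avoids π refl u≢v) (⟨$⟩ʳ-avoids π p↦ u≢p) (⟨$⟩ʳ-avoids π p↦ v≢p))

module Transport {N : ℕ} {G H : Graph N} (σ : G ≅ H) where
  open Shapes

  π : Permutation′ N
  π = proj₁ σ

  f g : Fin N → Fin N
  f = π ⟨$⟩ʳ_
  g = π ⟨$⟩ˡ_

  f∘g : ∀ y → f (g y) ≡ y
  f∘g y = inverseʳ π

  reflect : ∀ {u v x y β} → f u ≡ x → f v ≡ y → adj H x y ≡ β → adj G u v ≡ β
  reflect {u} {v} refl refl h = trans (proj₂ σ u v) h

  preimage : ∀ {u y} → f u ≡ y → u ≡ g y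
  preimage {y = y} fu = ⟨$⟩ʳ-injective π (trans fu (sym (f∘g y)))

  avoids : ∀ {u y} → u ≢ g y → f u ≢ y
  avoids u≢gy fu = u≢gy (preimage fu)

  distinct : ∀ {u v} → u ≢ v → f u ≢ f v
  distinct = ⟨$⟩ʳ-avoids π refl

  pair-preimage : ∀ {a b u v} → Pair a b (f u) (f v) → Pair (g a) (g b) u v
  pair-preimage (inj₁ (fu , fv)) = inj₁ (preimage fu , preimage fv)
  pair-preimage (inj₂ (fu , fv)) = inj₂ (preimage fu , preimage fv)

  pull-complete : IsComplete H → IsComplete G
  pull-complete completeH u≢v = reflect refl refl (completeH (distinct u≢v))

  pull-star : IsStar H → IsStar G
  pull-star starH = record
    { centre = g centre
    ; spoke = λ u≢c → reflect refl (f∘g centre) (spoke (avoids u≢c))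
    ; leaves-apart = λ u≢c v≢c → reflect refl refl (leaves-apart (avoids u≢c) (avoids v≢c)) }
    where open IsStar starH

  pull-split : IsSplit H → IsSplit G
  pull-split splitH = record
    { a = g a ; b = g b
    ; a≢b = λ eq → a≢b (trans (sym (f∘g a)) (trans (cong f eq) (f∘g b)))
    ; a≁b = reflect (f∘g a) (f∘g b) a≁b
    ; only-non-edge = λ {u} {v} u≢v u≁v →
        pair-preimage (only-non-edge (distinct u≢v) (trans (sym (proj₂ σ u v)) u≁v)) }
    where open IsSplit splitH

  pull-pendant : IsPendant H → IsPendant G
  pull-pendant pendantH = record
    { z = g z ; p = g p
    ; z≢p = λ eq → z≢p (trans (sym (f∘g z)) (trans (cong f eq) (f∘g p)))
    ; z-universal = λ u≢z → reflect (f∘g z) refl (z-universal (avoids u≢z))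
    ; p-pendant = λ u≢z → reflect (f∘g p) refl (p-pendant (avoids u≢z))
    ; clique = λ u≢v u≢p v≢p → reflect refl refl (clique (distinct u≢v) (avoids u≢p) (avoids v≢p)) }
    where open IsPendant pendantH

module Concrete (m : ℕ) where
  N : ℕ
  N = suc (suc m)

  0ᶠ 1ᶠ : Fin N
  0ᶠ = F.zero
  1ᶠ = F.suc F.zero

  ≠ᶠ-true : ∀ {x y : Fin N} → x ≢ y → (x ≠ᶠ y) ≡ true
  ≠ᶠ-true {x} {y} x≢y with x F.≟ y
  ... | yes x≡y = ⊥-elim (x≢y x≡y)
  ... | no _ = refl

  is0-false : ∀ {x : Fin N} → x ≢ 0ᶠ → is0 x ≡ false
  is0-false {F.zero} x≢0 = ⊥-elim (x≢0 refl)
  is0-false {F.suc _} _ = refl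

  is1-false : ∀ {x : Fin N} → x ≢ 1ᶠ → is1 x ≡ false
  is1-false {F.zero} _ = refl
  is1-false {F.suc F.zero} x≢1 = ⊥-elim (x≢1 refl)
  is1-false {F.suc (F.suc _)} _ = refl

  is0∧is1-false : ∀ {u v : Fin N} → ¬ (u ≡ 0ᶠ × v ≡ 1ᶠ) → (is0 u ∧ is1 v) ≡ false
  is0∧is1-false {u} {v} h with u F.≟ 0ᶠ | v F.≟ 1ᶠ
  ... | yes refl | yes refl = ⊥-elim (h (refl , refl))
  ... | yes refl | no v≢1 = is1-false v≢1
  ... | no u≢0 | _ = cong (_∧ is1 v) (is0-false u≢0)

  completeShape : Shapes.IsComplete (Complete N)
  completeShape = ≠ᶠ-true

  starShape : Shapes.IsStar (Star N)
  starShape = record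
    { centre = 0ᶠ
    ; spoke = λ {u} u≢0 → cong₂ _∧_ (≠ᶠ-true u≢0) (∨-zeroʳ (is0 u))
    ; leaves-apart = λ {u} {v} u≢0 v≢0 →
        trans (cong ((u ≠ᶠ v) ∧_) (cong₂ _∨_ (is0-false u≢0) (is0-false v≢0))) (∧-zeroʳ (u ≠ᶠ v)) }

  splitShape : Shapes.IsSplit (SplitK2 N)
  splitShape = record { a = 0ᶠ ; b = 1ᶠ ; a≢b = λ () ; a≁b = refl ; only-non-edge = onlyNonEdge }
    where
    onlyNonEdge : ∀ {u v} → u ≢ v → adj (SplitK2 N) u v ≡ false → Pair 0ᶠ 1ᶠ u v
    onlyNonEdge {u} {v} u≢v u≁v with (u F.≟ 0ᶠ ×-dec v F.≟ 1ᶠ) | (u F.≟ 1ᶠ ×-dec v F.≟ 0ᶠ)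
    ... | yes p | _ = inj₁ p
    ... | _ | yes q = inj₂ q
    ... | no ¬p | no ¬q = ⊥-elim (true≢false (trans (sym adjacent) u≁v))
      where
      adjacent : adj (SplitK2 N) u v ≡ true
      adjacent = cong₂ _∧_ (≠ᶠ-true u≢v)
        (cong not (cong₂ _∨_ (is0∧is1-false ¬p) (trans (∧-comm (is1 u) (is0 v)) (is0∧is1-false (¬q ∘ Data.Product.swap)))))

  pendantShape : Shapes.IsPendant (PendantK N)
  pendantShape = record
    { z = 0ᶠ ; p = 1ᶠ ; z≢p = λ ()
    ; z-universal = λ u≢0 → cong₂ _∧_ (≠ᶠ-true (≢-sym u≢0)) refl
    ; p-pendant = λ {u} u≢0 →
        trans (cong ((1ᶠ ≠ᶠ u) ∧_) (cong (_∨ false) (is0-false u≢0))) (∧-zeroʳ (1ᶠ ≠ᶠ u))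
    ; clique = λ {u} {v} u≢v u≢1 v≢1 → cong₂ _∧_ (≠ᶠ-true u≢v)
        (trans (cong (λ t → is0 u ∨ is0 v ∨ not t) (cong₂ _∨_ (is1-false u≢1) (is1-false v≢1)))
               (trans (cong (is0 u ∨_) (∨-zeroʳ (is0 v))) (∨-zeroʳ (is0 u)))) }

EtaP-unique : ∀ {n} {G : Graph n} {a b} → EtaP G a → EtaP G b → a ≡ b
EtaP-unique (A , minA) (B , minB) = ℕ.≤-antisym (minA _ B) (minB _ A)

module Eta {m : ℕ} (G : Graph (suc (suc m))) (six : 6 ≤ suc (suc m)) (conn : Connected G) where
  open Adjacency G
  open Shapes G
  open Configurations G

  N : ℕ
  N = suc (suc m)

  atLeastTwo : 2 ≤ N
  atLeastTwo = s≤s (s≤s z≤n)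

  singletons : ResDomPartition G N
  singletons = P , resolvingDominating conn (λ u≢v cu≡cv → ⊥-elim (u≢v cu≡cv))
    (λ x → let (y , x~y) = neighbour conn atLeastTwo x in y , ~⇒≢ x~y ∘ sym , x~y)
    where
    P : Partition N N
    P = record { cls = λ x → x ; onto = λ y → y , λ eq → eq }
    open Distances G P using (resolvingDominating)

  eta-complete : IsComplete → EtaP G N
  eta-complete c = singletons , λ k (P , res , _) → FinP.injective⇒≤ (LowerBounds.completeInjective G P res c)

  eta-star : IsStar → EtaP G N
  eta-star s = singletons , λ k (P , res , dom) → FinP.injective⇒≤ (LowerBounds.starInjective G P res s dom)

  -- in the split graph a vertex y ∉ {a, b} can be merged with a (separated by b)
  splitPair : IsSplit → MergeablePair
  splitPair s with avoid≤5 six (IsSplit.a s ∷ IsSplit.b s ∷ [])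
  ... | y , y≢a ∷ y≢b ∷ [] with avoid≤5 six (IsSplit.a s ∷ IsSplit.b s ∷ y ∷ [])
  ...   | y₂ , y₂≢a ∷ y₂≢b ∷ y₂≢y ∷ [] = record
          { u = y ; v = a ; w = b ; u≢v = y≢a ; w≢v = ≢-sym a≢b ; u~w = universal y≢a y≢b (≢-sym y≢b)
          ; v≁w = a≁b ; v-besides = y₂ , y₂≢y , a-sees y₂≢a y₂≢b }
    where open Split s

  eta-split : IsSplit → EtaP G (suc m)
  eta-split s = mergeOnePair G conn atLeastTwo (splitPair s) ,
    λ k (P , res , _) → let (x , inj) = LowerBounds.SplitBound.result G P res s in injectiveOff⇒≤ (cls P) x inj

  -- in the pendant graph a vertex y ∉ {z, p} can be merged with p (separated
  -- by another such vertex y₂)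
  pendantPair : IsPendant → MergeablePair
  pendantPair s with avoid≤5 six (IsPendant.z s ∷ IsPendant.p s ∷ [])
  ... | y , y≢z ∷ y≢p ∷ [] with avoid≤5 six (IsPendant.z s ∷ IsPendant.p s ∷ y ∷ [])
  ...   | y₂ , y₂≢z ∷ y₂≢p ∷ y₂≢y ∷ [] = record
          { u = y ; v = p ; w = y₂ ; u≢v = y≢p ; w≢v = y₂≢p ; u~w = clique (≢-sym y₂≢y) y≢p y₂≢p
          ; v≁w = p-pendant y₂≢z ; v-besides = z , ≢-sym y≢z , ~-sym (z-universal (≢-sym z≢p)) }
    where open IsPendant s

  eta-pendant : IsPendant → EtaP G (suc m)
  eta-pendant s = mergeOnePair G conn atLeastTwo (pendantPair s) ,
    λ k (P , res , dom) → let (x , inj) = LowerBounds.PendantBound.result G P res s dom in injectiveOff⇒≤ (cls P) x inj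

  twoPairsPartition : TwoMergeablePairs → ResDomPartition G m
  twoPairsPartition = mergeTwoPairs G conn atLeastTwo

mainTheorem2 : ∀ (n : ℕ) → 6 ≤ n → (G : Graph n) → Connected G →
    (EtaP G n ⇔ (G ≅ Complete n ⊎ G ≅ Star n)) ×
    (EtaP G (n ∸ 1) ⇔ (G ≅ SplitK2 n ⊎ G ≅ PendantK n))
mainTheorem2 (suc (suc m)) six@(s≤s (s≤s _)) G conn = mk⇔ extremal extremal⁻¹ , mk⇔ nearExtremal nearExtremal⁻¹
  where
  open Eta G six conn
  open SameShape
  open Concrete m hiding (N)
  open Transport

  extremal : EtaP G N → G ≅ Complete N ⊎ G ≅ Star N
  extremal eta with Classification.classify G six conn
  ... | complete c = inj₁ (complete≅ {G = G} {H = Complete N} c completeShape)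
  ... | star s = inj₂ (star≅ s starShape)
  ... | split s = ⊥-elim (ℕ.1+n≢n (EtaP-unique eta (eta-split s)))
  ... | pendant s = ⊥-elim (ℕ.1+n≢n (EtaP-unique eta (eta-pendant s)))
  ... | twoPairs t = ⊥-elim (ℕ.1+n≰n (ℕ.≤-trans (ℕ.n≤1+n _) (proj₂ eta m (twoPairsPartition t))))

  extremal⁻¹ : G ≅ Complete N ⊎ G ≅ Star N → EtaP G N
  extremal⁻¹ (inj₁ σ) = eta-complete (pull-complete {G = G} {H = Complete N} σ completeShape)
  extremal⁻¹ (inj₂ σ) = eta-star (pull-star σ starShape)

  nearExtremal : EtaP G (suc m) → G ≅ SplitK2 N ⊎ G ≅ PendantK N
  nearExtremal eta with Classification.classify G six conn
  ... | complete c = ⊥-elim (ℕ.1+n≢n (EtaP-unique (eta-complete c) eta))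
  ... | star s = ⊥-elim (ℕ.1+n≢n (EtaP-unique (eta-star s) eta))
  ... | split s = inj₁ (split≅ s splitShape)
  ... | pendant s = inj₂ (pendant≅ s pendantShape)
  ... | twoPairs t = ⊥-elim (ℕ.1+n≰n (proj₂ eta m (twoPairsPartition t)))

  nearExtremal⁻¹ : G ≅ SplitK2 N ⊎ G ≅ PendantK N → EtaP G (suc m)
  nearExtremal⁻¹ (inj₁ σ) = eta-split (pull-split σ splitShape)
  nearExtremal⁻¹ (inj₂ σ) = eta-pendant (pull-pendant σ pendantShape)
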